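{- The class $\mathrm{Age}(C_3[I_\omega]^*)$ has the Ramsey property.
   Context: $C_3$ is the 3-cycle tournament on $\{0,1,2\}$ with edges $0\to1$, $1\to2$, $2\to0$. $C_3[I_\omega]^*$ is the structure with universe $\{0,1,2\}\times\mathbb N$, with directed edges $E((x,i),(y,j))$ iff $(x,y)$ is an edge of $C_3$, with unary predicates $P_x=\{(x,j):j\in\mathbb N\}$ for $x\in\{0,1,2\}$, and with a linear order $<$ such that $P_0<P_1<P_2$ and the restriction of $<$ to each $P_x$ is a dense linear order (without endpoints). The age of a structure is the class of finite structures embeddable in it. A class $\mathcal K$ of finite structures has the Ramsey property if for all $k\in\mathbb N$ and $\mathbf A,\mathbf B\in\mathcal K$ there is $\mathbf C\in\mathcal K$ such that for every colouring of the substructures of $\mathbf C$ isomorphic to $\mathbf A$ with $k$ colours there is a substructure $\mathbf B'\cong\mathbf B$ of $\mathbf C$ on whose substructures isomorphic to $\mathbf A$ the colouring is constant. -}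

module Defs where

open import Level using (0ℓ)
open import Data.Nat using (ℕ)
open import Data.Fin using (Fin; zero; suc)
import Data.Fin as F
open import Data.Rational as ℚ using (ℚ)
open import Data.Product using (Σ; Σ-syntax; ∃; ∃-syntax; _×_; _,_)
open import Data.Sum using (_⊎_)
open import Data.Empty using (⊥)
open import Data.Unit using (⊤)
open import Relation.Binary.PropositionalEquality using (_≡_)
open import Function.Bundles using (_⇔_)
open import Function.Definitions using (Injective)
open import Data.Fin.Subset using (Subset; _∈_; _⊆_)

record Structure : Set₁ where
  field
    Carrier : Set
    E       : Carrier → Carrier → Set
    P       : Fin 3 → Carrier → Set
    Lt      : Carrier → Carrier → Set
open Structure public

record Embedding (A B : Structure) : Set where
  field
    fun   : Carrier A → Carrier B
    inj   : Injective _≡_ _≡_ fun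
    E⇔    : ∀ a b → E A a b ⇔ E B (fun a) (fun b)
    P⇔    : ∀ i a → P A i a ⇔ P B i (fun a)
    Lt⇔   : ∀ a b → Lt A a b ⇔ Lt B (fun a) (fun b)
open Embedding public

C3Edge : Fin 3 → Fin 3 → Set
C3Edge zero (suc zero) = ⊤
C3Edge (suc zero) (suc (suc zero)) = ⊤
C3Edge (suc (suc zero)) zero = ⊤
C3Edge _ _ = ⊥

-- C₃[I_ω]* : universe {0,1,2} × ℚ (each part ordered as ℚ, a countable dense
-- linear order without endpoints, hence isomorphic to the paper's copy of ℕ),
-- with P₀ < P₁ < P₂.
C3Iω* : Structure
C3Iω* = record
  { Carrier = Fin 3 × ℚ
  ; E  = λ { (x , _) (y , _) → C3Edge x y }
  ; P  = λ { i (x , _) → x ≡ i }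
  ; Lt = λ { (x , p) (y , q) → (x F.< y) ⊎ (x ≡ y × p ℚ.< q) }
  }

record FinStructure : Set₁ where
  field
    size : ℕ
    E    : Fin size → Fin size → Set
    P    : Fin 3 → Fin size → Set
    Lt   : Fin size → Fin size → Set

toStructure : FinStructure → Structure
toStructure A = record
  { Carrier = Fin (FinStructure.size A)
  ; E = FinStructure.E A ; P = FinStructure.P A ; Lt = FinStructure.Lt A }

Age : Structure → FinStructure → Set
Age M A = Embedding (toStructure A) M

SubsetOf : FinStructure → Set
SubsetOf C = Subset (FinStructure.size C)

-- The substructure of C on universe S is isomorphic to A:
-- S is exactly the image of some embedding A → C.
IsCopyOf : (A C : FinStructure) → SubsetOf C → Set
IsCopyOf A C S = Σ[ g ∈ Embedding (toStructure A) (toStructure C) ]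
  (∀ x → x ∈ S ⇔ (∃[ a ] fun g a ≡ x))

-- The Ramsey property of a class K of finite structures.
-- A k-colouring assigns a colour to every substructure (subset) of C;
-- only its values on copies of A matter.
RamseyProperty : (FinStructure → Set) → Set₁
RamseyProperty K =
  (k : ℕ) (A B : FinStructure) → K A → K B →
  Σ[ C ∈ FinStructure ] (K C ×
    ((χ : SubsetOf C → Fin k) →
      Σ[ B' ∈ SubsetOf C ] (IsCopyOf B C B' ×
        (∀ S T → S ⊆ B' → T ⊆ B' →
          IsCopyOf A C S → IsCopyOf A C T → χ S ≡ χ T))))

module Submission where

-- A finite structure A in the age is determined by which part P₀, P₁, P₂
-- each point lies in and by the order of the points inside each part.
-- Hence a copy of A inside the "grid" of three columns of height N (column
-- i placed in part i) is the same as a triple of order-preserving maps,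
-- thinnings, from the i-th part of A into column i.  The Ramsey property
-- is thereby reduced to a product Ramsey theorem for tuples of thinnings,
-- which follows from the classical finite Ramsey theorem by concatenating
-- the blocks of a tuple into one thinning.

open import Defs
open import Data.Nat as ℕ using (ℕ; zero; suc; _+_; _*_; _≤_; z≤n; s≤s; _≤?_)
open import Data.Nat.Properties using (≤-antisym; ≤-trans; n≤1+n; ∸-monoʳ-≤; m+n∸m≡n; ≰⇒>; <⇒≤; <-cmp)
import Data.Nat.Coprimality as Coprime
import Data.Integer as ℤ
import Data.Integer.Properties as ℤ
open import Data.Rational as ℚ using (ℚ; mkℚ)
import Data.Rational.Properties as ℚ
open import Data.Fin as F using (Fin; zero; suc; toℕ; punchOut; combine; remQuot)
open import Data.Fin.Properties using (_≟_; ¬Fin0; suc-injective; toℕ-injective; toℕ-fromℕ<; injective⇒≤; punchIn-punchOut; remQuot-combine; combine-remQuot; any?)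
open import Data.Fin.Subset as Sub using (Subset; inside; outside; _∈_; _⊆_; ∁; ∣_∣)
open import Data.Fin.Subset.Properties using (drop-∷-⊆; ∣∁p∣≡n∸∣p∣; x∈∁p⇒x∉p; ∈⊤; ∣⊤∣≡n; p⊂q⇒∣p∣<∣q∣)
open import Data.Bool using (true)
open import Data.Vec using ([]; _∷_; here; there; tabulate; lookup)
open import Data.Vec.Properties using ([]=⇒lookup; lookup⇒[]=; lookup∘tabulate; tabulate∘lookup; tabulate-cong)
open import Data.Product using (Σ-syntax; ∃-syntax; _×_; _,_; proj₁; proj₂)
open import Data.Sum using (inj₁; inj₂)
open import Data.Empty using (⊥-elim)
open import Function using (_∘_)
open import Function.Bundles using (_⇔_; mk⇔; Equivalence)
open import Function.Construct.Identity using (⇔-id)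
open import Function.Construct.Composition using (_⇔-∘_)
open import Function.Definitions using (Injective)
open import Relation.Nullary using (¬_; Dec; yes; no; does)
open import Relation.Nullary.Decidable using (dec-true)
open import Relation.Binary.Definitions using (tri<; tri≈; tri>)
open import Relation.Binary.PropositionalEquality
open Equivalence using (to; from)
open FinStructure using (size)
open ≡-Reasoning

-- A thinning m ⊑ n is an order-preserving injection Fin m → Fin n,
-- recorded by which of the n positions are kept.
infix 4 _⊑_
data _⊑_ : ℕ → ℕ → Set where
  done : zero ⊑ zero
  keep : ∀ {m n} → m ⊑ n → suc m ⊑ suc n
  drop : ∀ {m n} → m ⊑ n → m ⊑ suc n

-- Composition in diagrammatic order: s ⨾ t is s followed by t.
infixr 9 _⨾_
_⨾_ : ∀ {a b c} → a ⊑ b → b ⊑ c → a ⊑ c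
s      ⨾ done   = s
s      ⨾ drop t = drop (s ⨾ t)
keep s ⨾ keep t = keep (s ⨾ t)
drop s ⨾ keep t = drop (s ⨾ t)

⨾-assoc : ∀ {a b c d} (s : a ⊑ b) (t : b ⊑ c) (u : c ⊑ d) → (s ⨾ t) ⨾ u ≡ s ⨾ t ⨾ u
⨾-assoc s        t        done     = refl
⨾-assoc s        t        (drop u) = cong drop (⨾-assoc s t u)
⨾-assoc s        (drop t) (keep u) = cong drop (⨾-assoc s t u)
⨾-assoc (keep s) (keep t) (keep u) = cong keep (⨾-assoc s t u)
⨾-assoc (drop s) (keep t) (keep u) = cong drop (⨾-assoc s t u)

⨾-slide : ∀ {a b b′ c d} {s : a ⊑ b} {t : b ⊑ c} {t′ : a ⊑ b′} {s′ : b′ ⊑ c} →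
          s ⨾ t ≡ t′ ⨾ s′ → (f : c ⊑ d) → s ⨾ t ⨾ f ≡ t′ ⨾ s′ ⨾ f
⨾-slide {s = s} {t} {t′} {s′} e f = begin
  s ⨾ t ⨾ f      ≡⟨ sym (⨾-assoc s t f) ⟩
  (s ⨾ t) ⨾ f    ≡⟨ cong (_⨾ f) e ⟩
  (t′ ⨾ s′) ⨾ f  ≡⟨ ⨾-assoc t′ s′ f ⟩
  t′ ⨾ s′ ⨾ f    ∎

id⊑ : ∀ {n} → n ⊑ n
id⊑ {zero}  = done
id⊑ {suc n} = keep id⊑

⨾-identityˡ : ∀ {a b} (s : a ⊑ b) → id⊑ ⨾ s ≡ s
⨾-identityˡ done     = refl
⨾-identityˡ (keep s) = cong keep (⨾-identityˡ s)
⨾-identityˡ (drop s) = cong drop (⨾-identityˡ s)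

⨾-identityʳ : ∀ {a b} (s : a ⊑ b) → s ⨾ id⊑ ≡ s
⨾-identityʳ done     = refl
⨾-identityʳ (keep s) = cong keep (⨾-identityʳ s)
⨾-identityʳ (drop s) = cong drop (⨾-identityʳ s)

empty⊑ : ∀ {n} → zero ⊑ n
empty⊑ {zero}  = done
empty⊑ {suc n} = drop empty⊑

empty⊑-unique : ∀ {n} (s t : zero ⊑ n) → s ≡ t
empty⊑-unique done     done     = refl
empty⊑-unique (drop s) (drop t) = cong drop (empty⊑-unique s t)

pos : ∀ {m n} → m ⊑ n → Fin m → Fin n
pos (keep t) zero    = zero
pos (keep t) (suc i) = suc (pos t i)
pos (drop t) i       = suc (pos t i)

pos-⨾ : ∀ {a b c} (s : a ⊑ b) (t : b ⊑ c) i → pos (s ⨾ t) i ≡ pos t (pos s i)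
pos-⨾ done     done     ()
pos-⨾ s        (drop t) i       = cong suc (pos-⨾ s t i)
pos-⨾ (keep s) (keep t) zero    = refl
pos-⨾ (keep s) (keep t) (suc i) = cong suc (pos-⨾ s t i)
pos-⨾ (drop s) (keep t) i       = cong suc (pos-⨾ s t i)

pos-injective : ∀ {m n} (t : m ⊑ n) → Injective _≡_ _≡_ (pos t)
pos-injective (keep t) {zero}  {zero}  e = refl
pos-injective (keep t) {suc i} {suc j} e = cong suc (pos-injective t (suc-injective e))
pos-injective (drop t)                 e = pos-injective t (suc-injective e)

pos-mono : ∀ {m n} (t : m ⊑ n) {i j : Fin m} → i F.< j → pos t i F.< pos t j
pos-mono (keep t) {zero}  {suc j} i<j       = s≤s z≤n
pos-mono (keep t) {suc i} {suc j} (s≤s i<j) = s≤s (pos-mono t i<j)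
pos-mono (drop t)                 i<j       = s≤s (pos-mono t i<j)

≤⇒⊑ : ∀ {m n} → m ≤ n → m ⊑ n
≤⇒⊑ z≤n       = empty⊑
≤⇒⊑ (s≤s m≤n) = keep (≤⇒⊑ m≤n)

⊑⇒≤ : ∀ {m n} → m ⊑ n → m ≤ n
⊑⇒≤ done     = z≤n
⊑⇒≤ (keep t) = s≤s (⊑⇒≤ t)
⊑⇒≤ (drop t) = ≤-trans (⊑⇒≤ t) (n≤1+n _)

infixr 5 _⊕_
_⊕_ : ∀ {a b c d} → a ⊑ b → c ⊑ d → a + c ⊑ b + d
done   ⊕ v = v
keep u ⊕ v = keep (u ⊕ v)
drop u ⊕ v = drop (u ⊕ v)

inl : ∀ a c → a ⊑ a + c
inl zero    c = empty⊑
inl (suc a) c = keep (inl a c)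

inr : ∀ a c → c ⊑ a + c
inr zero    c = id⊑
inr (suc a) c = drop (inr a c)

inl-⊕ : ∀ {a b c d} (u : a ⊑ b) (v : c ⊑ d) → inl a c ⨾ (u ⊕ v) ≡ u ⨾ inl b d
inl-⊕ done     v = empty⊑-unique _ _
inl-⊕ (keep u) v = cong keep (inl-⊕ u v)
inl-⊕ (drop u) v = cong drop (inl-⊕ u v)

inr-⊕ : ∀ {a b c d} (u : a ⊑ b) (v : c ⊑ d) → inr a c ⨾ (u ⊕ v) ≡ v ⨾ inr b d
inr-⊕ done     v = trans (⨾-identityˡ v) (sym (⨾-identityʳ v))
inr-⊕ (keep u) v = cong drop (inr-⊕ u v)
inr-⊕ (drop u) v = cong drop (inr-⊕ u v)

toSub : ∀ {m n} → m ⊑ n → Subset n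
toSub done     = []
toSub (keep t) = inside ∷ toSub t
toSub (drop t) = outside ∷ toSub t

toSub-pos : ∀ {m n} (t : m ⊑ n) j → pos t j ∈ toSub t
toSub-pos (keep t) zero    = here
toSub-pos (keep t) (suc j) = there (toSub-pos t j)
toSub-pos (drop t) j       = there (toSub-pos t j)

toSub-mem : ∀ {m n} (t : m ⊑ n) {x} → x ∈ toSub t → ∃[ j ] pos t j ≡ x
toSub-mem (keep t) here       = zero , refl
toSub-mem (keep t) (there x∈) = let j , e = toSub-mem t x∈ in suc j , cong suc e
toSub-mem (drop t) (there x∈) = let j , e = toSub-mem t x∈ in j , cong suc e

factor : ∀ {a b n} (t : a ⊑ n) (f : b ⊑ n) → toSub t ⊆ toSub f → Σ[ u ∈ a ⊑ b ] u ⨾ f ≡ t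
factor done     done     _ = done , refl
factor (keep t) (keep f) t⊆f = let u , e = factor t f (drop-∷-⊆ t⊆f) in keep u , cong keep e
factor (drop t) (keep f) t⊆f = let u , e = factor t f (drop-∷-⊆ t⊆f) in drop u , cong drop e
factor (drop t) (drop f) t⊆f = let u , e = factor t f (drop-∷-⊆ t⊆f) in u , cong drop e
factor (keep t) (drop f) t⊆f with t⊆f here
... | ()

fromSub : ∀ {n} (V : Subset n) → ∣ V ∣ ⊑ n
fromSub []            = done
fromSub (inside ∷ V)  = keep (fromSub V)
fromSub (outside ∷ V) = drop (fromSub V)

toSub-fromSub : ∀ {n} (V : Subset n) → toSub (fromSub V) ≡ V
toSub-fromSub []            = refl
toSub-fromSub (inside ∷ V)  = cong (inside ∷_) (toSub-fromSub V)
toSub-fromSub (outside ∷ V) = cong (outside ∷_) (toSub-fromSub V)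

fromSub-∈ : ∀ {n} (V : Subset n) j → pos (fromSub V) j ∈ V
fromSub-∈ V j = subst (pos (fromSub V) j ∈_) (toSub-fromSub V) (toSub-pos (fromSub V) j)

⨾-fromSub-∈ : ∀ {m n} (V : Subset n) (s : m ⊑ ∣ V ∣) i → pos (s ⨾ fromSub V) i ∈ V
⨾-fromSub-∈ V s i = subst (_∈ V) (sym (pos-⨾ s (fromSub V) i)) (fromSub-∈ V (pos s i))

fromSub-onto : ∀ {n} (V : Subset n) {x} → x ∈ V → ∃[ j ] pos (fromSub V) j ≡ x
fromSub-onto V {x} x∈V = toSub-mem (fromSub V) (subst (x ∈_) (sym (toSub-fromSub V)) x∈V)

select : ∀ {n} {P : Fin n → Set} → (∀ x → Dec (P x)) → Subset n
select P? = tabulate (λ x → does (P? x))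

∈-select : ∀ {n} {P : Fin n → Set} (P? : ∀ x → Dec (P x)) x → x ∈ select P? ⇔ P x
∈-select P? x = mk⇔
  (λ x∈ → witness (P? x) (trans (sym (lookup∘tabulate _ x)) ([]=⇒lookup x∈)))
  (λ p → lookup⇒[]= x _ (trans (lookup∘tabulate _ x) (dec-true (P? x) p)))
  where
  witness : ∀ {A : Set} (d : Dec A) → does d ≡ true → A
  witness (yes a) _ = a

image-size : ∀ {p q} (V : Subset q) (h : Fin p → Fin q) → Injective _≡_ _≡_ h →
             (∀ y → y ∈ V ⇔ (∃[ x ] h x ≡ y)) → ∣ V ∣ ≡ p
image-size {p} V h h-inj image =
  ≤-antisym (injective⇒≤ {f = preimage} preimage-inj) (injective⇒≤ {f = index} index-inj)
  where
  enum : Fin ∣ V ∣ → _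
  enum = pos (fromSub V)
  preimage : Fin ∣ V ∣ → Fin p
  preimage j = proj₁ (to (image (enum j)) (fromSub-∈ V j))
  h-preimage : ∀ j → h (preimage j) ≡ enum j
  h-preimage j = proj₂ (to (image (enum j)) (fromSub-∈ V j))
  index : Fin p → Fin ∣ V ∣
  index x = proj₁ (fromSub-onto V (from (image (h x)) (x , refl)))
  enum-index : ∀ x → enum (index x) ≡ h x
  enum-index x = proj₂ (fromSub-onto V (from (image (h x)) (x , refl)))
  preimage-inj : Injective _≡_ _≡_ preimage
  preimage-inj {j} {j′} e =
    pos-injective (fromSub V) (trans (sym (h-preimage j)) (trans (cong h e) (h-preimage j′)))
  index-inj : Injective _≡_ _≡_ index
  index-inj {x} {x′} e = h-inj (trans (sym (enum-index x)) (trans (cong enum e) (enum-index x′)))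

thinning-of-size : ∀ {p n} (V : Subset n) → ∣ V ∣ ≡ p → Σ[ t ∈ p ⊑ n ] toSub t ≡ V
thinning-of-size V refl = fromSub V , toSub-fromSub V

-- Ramsey's theorem for r-element subsets with k+1 colours, phrased with
-- thinnings: every colouring of the r-subsets of a large enough M is
-- constant on the r-subsets of some n-subset f.
Ramsey : ℕ → ℕ → Set
Ramsey r k = (n : ℕ) → Σ[ M ∈ ℕ ] ((c : r ⊑ M → Fin (suc k)) →
  Σ[ f ∈ n ⊑ M ] (∀ (s t : r ⊑ n) → c (s ⨾ f) ≡ c (t ⨾ f)))

-- Split off the points of colour zero; if there
-- are fewer than n of them, at least L points remain, coloured with one
-- colour less.
pigeonhole : (k n : ℕ) → Σ[ L ∈ ℕ ] ((g : Fin L → Fin (suc k)) →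
  Σ[ h ∈ n ⊑ L ] Σ[ col ∈ Fin (suc k) ] (∀ i → g (pos h i) ≡ col))
pigeonhole zero    n = n , λ g → id⊑ , zero , λ i → only-zero (g (pos id⊑ i))
  where
  only-zero : (x : Fin 1) → x ≡ zero
  only-zero zero = refl
pigeonhole (suc k) n = n + L , split
  where
  L = proj₁ (pigeonhole k n)
  zeros : (Fin (n + L) → Fin (suc (suc k))) → Subset (n + L)
  zeros g = select (λ x → g x ≟ zero)
  ∈-zeros : ∀ g x → x ∈ zeros g ⇔ g x ≡ zero
  ∈-zeros g = ∈-select (λ x → g x ≟ zero)
  split : (g : Fin (n + L) → Fin (suc (suc k))) →
    Σ[ h ∈ n ⊑ n + L ] Σ[ col ∈ Fin (suc (suc k)) ] (∀ i → g (pos h i) ≡ col)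
  split g with n ≤? ∣ zeros g ∣
  ... | yes n≤z = ≤⇒⊑ n≤z ⨾ fromSub (zeros g) , zero , λ i →
          to (∈-zeros g _) (⨾-fromSub-∈ (zeros g) (≤⇒⊑ n≤z) i)
  ... | no n≰z = h ⨾ t , suc col , λ i → trans (cong g (pos-⨾ h t i)) (coloured i)
    where
    L≤rest : L ≤ ∣ ∁ (zeros g) ∣
    L≤rest = subst₂ _≤_ (m+n∸m≡n n L) (sym (∣∁p∣≡n∸∣p∣ (zeros g)))
                    (∸-monoʳ-≤ (n + L) (<⇒≤ (≰⇒> n≰z)))
    t : L ⊑ n + L
    t = ≤⇒⊑ L≤rest ⨾ fromSub (∁ (zeros g))
    nonzero : ∀ j → zero ≢ g (pos t j)
    nonzero j g≡0 = x∈∁p⇒x∉p (⨾-fromSub-∈ (∁ (zeros g)) (≤⇒⊑ L≤rest) j) (from (∈-zeros g _) (sym g≡0))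
    -- on them, lowering every colour by one leaves k+1 colours
    recolour = proj₂ (pigeonhole k n) (λ j → punchOut (nonzero j))
    h = proj₁ recolour
    col = proj₁ (proj₂ recolour)
    coloured : ∀ i → g (pos t (pos h i)) ≡ suc col
    coloured i = trans (sym (punchIn-punchOut (nonzero (pos h i))))
                       (cong suc (proj₂ (proj₂ recolour) i))

-- Position 0
-- is fixed, Ramsey makes the sets containing it monochromatic inside some
-- h, and recursion handles the sets avoiding it.
end-homogeneous : ∀ r k → Ramsey r k → (L : ℕ) → Σ[ M ∈ ℕ ] ((c : suc r ⊑ M → Fin (suc k)) →
  Σ[ f ∈ L ⊑ M ] Σ[ g ∈ (Fin L → Fin (suc k)) ] (∀ (s : suc r ⊑ L) → c (s ⨾ f) ≡ g (pos s zero)))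
end-homogeneous r k R zero    = zero , λ c → done , (λ ()) , λ ()
end-homogeneous r k R (suc L) = suc N , step
  where
  M = proj₁ (end-homogeneous r k R L)
  N = proj₁ (R M)
  step : (c : suc r ⊑ suc N → Fin (suc k)) → Σ[ f ∈ suc L ⊑ suc N ]
    Σ[ g ∈ (Fin (suc L) → Fin (suc k)) ] (∀ (s : suc r ⊑ suc L) → c (s ⨾ f) ≡ g (pos s zero))
  step c = keep (f ⨾ h) , g , end-hom
    where
    with-head = proj₂ (R M) (λ t → c (keep t))
    h = proj₁ with-head
    without-head = proj₂ (end-homogeneous r k R L) (λ s → c (drop (s ⨾ h)))
    f = proj₁ without-head
    g′ = proj₁ (proj₂ without-head)
    -- the common colour of the sets through position 0 (any colour if there are none)
    head-colour : Dec (r ≤ M) → Fin (suc k)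
    head-colour (yes r≤M) = c (keep (≤⇒⊑ r≤M ⨾ h))
    head-colour (no _)    = zero
    head-hom : (s : r ⊑ M) (d : Dec (r ≤ M)) → c (keep (s ⨾ h)) ≡ head-colour d
    head-hom s (yes r≤M) = proj₂ with-head s (≤⇒⊑ r≤M)
    head-hom s (no r≰M)  = ⊥-elim (r≰M (⊑⇒≤ s))
    g : Fin (suc L) → Fin (suc k)
    g zero    = head-colour (r ≤? M)
    g (suc i) = g′ i
    end-hom : (s : suc r ⊑ suc L) → c (s ⨾ keep (f ⨾ h)) ≡ g (pos s zero)
    end-hom (keep s) = trans (cong (c ∘ keep) (sym (⨾-assoc s f h))) (head-hom (s ⨾ f) (r ≤? M))
    end-hom (drop s) = trans (cong (c ∘ drop) (sym (⨾-assoc s f h))) (proj₂ (proj₂ without-head) s)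

-- Ramsey's theorem, by induction on r: make the colouring end-homogeneous
-- on a set large enough for the pigeonhole principle, then pick n first
-- elements of the same colour.
ramsey : ∀ r k → Ramsey r k
ramsey zero    k n = n , λ c → id⊑ , λ s t → cong (λ z → c (z ⨾ id⊑)) (empty⊑-unique s t)
ramsey (suc r) k n = M , homogeneous
  where
  L = proj₁ (pigeonhole k n)
  M = proj₁ (end-homogeneous r k (ramsey r k) L)
  homogeneous : (c : suc r ⊑ M → Fin (suc k)) →
    Σ[ f ∈ n ⊑ M ] (∀ (s t : suc r ⊑ n) → c (s ⨾ f) ≡ c (t ⨾ f))
  homogeneous c = h ⨾ f , λ s t → trans (monochrome s) (sym (monochrome t))
    where
    end-hom = proj₂ (end-homogeneous r k (ramsey r k) L) c
    f = proj₁ end-hom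
    g = proj₁ (proj₂ end-hom)
    same-first = proj₂ (pigeonhole k n) g
    h = proj₁ same-first
    col = proj₁ (proj₂ same-first)
    monochrome : (s : suc r ⊑ n) → c (s ⨾ h ⨾ f) ≡ col
    monochrome s = begin
      c (s ⨾ h ⨾ f)          ≡⟨ cong c (sym (⨾-assoc s h f)) ⟩
      c ((s ⨾ h) ⨾ f)        ≡⟨ proj₂ (proj₂ end-hom) (s ⨾ h) ⟩
      g (pos (s ⨾ h) zero)   ≡⟨ cong g (pos-⨾ s h zero) ⟩
      g (pos h (pos s zero)) ≡⟨ proj₂ (proj₂ same-first) (pos s zero) ⟩
      col                    ∎

total : ∀ {d} → (Fin d → ℕ) → ℕ
total {zero}  a = zero
total {suc d} a = a zero + total (a ∘ suc)

blocks : ∀ {d N} (a : Fin d → ℕ) → total a ⊑ N → (i : Fin d) → a i ⊑ N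
blocks a t zero    = inl (a zero) (total (a ∘ suc)) ⨾ t
blocks a t (suc i) = blocks (a ∘ suc) (inr (a zero) (total (a ∘ suc)) ⨾ t) i

concat : ∀ {d} {a b : Fin d → ℕ} → ((i : Fin d) → a i ⊑ b i) → total a ⊑ total b
concat {zero}  u = done
concat {suc d} u = u zero ⊕ concat (u ∘ suc)

blocks-concat : ∀ {d N} {a b : Fin d → ℕ} (u : (i : Fin d) → a i ⊑ b i) (f : total b ⊑ N) i →
                blocks a (concat u ⨾ f) i ≡ u i ⨾ blocks b f i
blocks-concat u f zero    = ⨾-slide (inl-⊕ (u zero) (concat (u ∘ suc))) f
blocks-concat {b = b} u f (suc i) = begin
  blocks _ (inr _ _ ⨾ concat u ⨾ f) i                 ≡⟨ cong (λ t → blocks _ t i)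
                                                           (⨾-slide (inr-⊕ (u zero) (concat (u ∘ suc))) f) ⟩
  blocks _ (concat (u ∘ suc) ⨾ inr _ _ ⨾ f) i         ≡⟨ blocks-concat (u ∘ suc) (inr (b zero) _ ⨾ f) i ⟩
  u (suc i) ⨾ blocks (b ∘ suc) (inr (b zero) _ ⨾ f) i ∎

-- Apply Ramsey to thinnings out of
-- total a and cut them into blocks.
product-ramsey : ∀ {d} (k : ℕ) (a b : Fin d → ℕ) → Σ[ N ∈ ℕ ]
  ((c : ((i : Fin d) → a i ⊑ N) → Fin (suc k)) → (∀ {t t′} → (∀ i → t i ≡ t′ i) → c t ≡ c t′) →
   Σ[ F ∈ ((i : Fin d) → b i ⊑ N) ]
     (∀ (u v : (i : Fin d) → a i ⊑ b i) → c (λ i → u i ⨾ F i) ≡ c (λ i → v i ⨾ F i)))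
product-ramsey k a b = N , homogeneous
  where
  N = proj₁ (ramsey (total a) k (total b))
  homogeneous : (c : ((i : Fin _) → a i ⊑ N) → Fin (suc k)) → (∀ {t t′} → (∀ i → t i ≡ t′ i) → c t ≡ c t′) →
    Σ[ F ∈ ((i : Fin _) → b i ⊑ N) ]
      (∀ (u v : (i : Fin _) → a i ⊑ b i) → c (λ i → u i ⨾ F i) ≡ c (λ i → v i ⨾ F i))
  homogeneous c c-ext = blocks b f , λ u v → begin
    c (λ i → u i ⨾ blocks b f i)    ≡⟨ c-ext (λ i → sym (blocks-concat u f i)) ⟩
    c (blocks a (concat u ⨾ f))     ≡⟨ proj₂ hom (concat u) (concat v) ⟩
    c (blocks a (concat v ⨾ f))     ≡⟨ c-ext (blocks-concat v f) ⟩
    c (λ i → v i ⨾ blocks b f i)    ∎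
    where
    hom = proj₂ (ramsey (total a) k (total b)) (λ t → c (blocks a t))
    f = proj₁ hom

-- Ranking: a finite family of keys in a decidable strict order is placed
-- order-preservingly into Fin s by counting the keys strictly below.
module Ranking {A : Set} {_≺_ : A → A → Set}
               (≺-trans : ∀ {x y z} → x ≺ y → y ≺ z → x ≺ z)
               (≺-irrefl : ∀ {x} → ¬ (x ≺ x))
               (_≺?_ : ∀ x y → Dec (x ≺ y))
               {s : ℕ} (key : Fin s → A) where

  below : Fin s → Subset s
  below y = select (λ z → key z ≺? key y)

  ∈-below : ∀ y z → z ∈ below y ⇔ key z ≺ key y
  ∈-below y = ∈-select (λ z → key z ≺? key y)

  not-below-self : ∀ y → ¬ (y ∈ below y)
  not-below-self y y∈ = ≺-irrefl (to (∈-below y y) y∈)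

  -- y itself witnesses that below y is a proper subset of everything.
  below-size : ∀ y → ∣ below y ∣ ℕ.< s
  below-size y = subst (∣ below y ∣ ℕ.<_) (∣⊤∣≡n s)
    (p⊂q⇒∣p∣<∣q∣ ((λ _ → ∈⊤) , y , ∈⊤ , not-below-self y))

  rank : Fin s → Fin s
  rank y = F.fromℕ< (below-size y)

  -- A larger key has a strictly larger set below it, witnessed by y.
  rank-mono : ∀ {y y′} → key y ≺ key y′ → rank y F.< rank y′
  rank-mono {y} {y′} y≺y′ =
    subst₂ ℕ._<_ (sym (toℕ-fromℕ< (below-size y))) (sym (toℕ-fromℕ< (below-size y′)))
      (p⊂q⇒∣p∣<∣q∣ ((λ {z} z∈ → from (∈-below y′ z) (≺-trans (to (∈-below y z) z∈) y≺y′)) ,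
                    y , from (∈-below y′ y) y≺y′ , not-below-self y))

-- The grid Fin (d * N) viewed as d columns of height N.
module Grid (d N : ℕ) where

  cell : Fin d → Fin N → Fin (d * N)
  cell = combine

  column : Fin (d * N) → Fin d
  column x = proj₁ (remQuot {d} N x)

  height : Fin (d * N) → Fin N
  height x = proj₂ (remQuot {d} N x)

  column-cell : ∀ i j → column (cell i j) ≡ i
  column-cell i j = cong proj₁ (remQuot-combine {d} {N} i j)

  height-cell : ∀ i j → height (cell i j) ≡ j
  height-cell i j = cong proj₂ (remQuot-combine {d} {N} i j)

  cell-column-height : ∀ x → cell (column x) (height x) ≡ x
  cell-column-height = combine-remQuot {d} N

  in-column : ∀ {x i} → column x ≡ i → x ≡ cell i (height x)
  in-column {x} refl = sym (cell-column-height x)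

  slice : Fin d → Subset (d * N) → Subset N
  slice i S = tabulate (λ j → lookup S (cell i j))

  glue : (Fin d → Subset N) → Subset (d * N)
  glue U = tabulate (λ x → lookup (U (column x)) (height x))

  ∈-slice : ∀ i S j → j ∈ slice i S ⇔ cell i j ∈ S
  ∈-slice i S j = mk⇔
    (λ j∈ → lookup⇒[]= _ S (trans (sym (lookup∘tabulate _ j)) ([]=⇒lookup j∈)))
    (λ x∈ → lookup⇒[]= j _ (trans (lookup∘tabulate _ j) ([]=⇒lookup x∈)))

  ∈-glue : ∀ U i j → cell i j ∈ glue U ⇔ j ∈ U i
  ∈-glue U i j = mk⇔
    (λ x∈ → lookup⇒[]= j (U i) (trans (sym (lookup-glue)) ([]=⇒lookup x∈)))
    (λ j∈ → lookup⇒[]= (cell i j) _ (trans lookup-glue ([]=⇒lookup j∈)))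
    where
    lookup-glue : lookup (glue U) (cell i j) ≡ lookup (U i) j
    lookup-glue = trans (lookup∘tabulate _ (cell i j))
                        (cong₂ (λ i′ j′ → lookup (U i′) j′) (column-cell i j) (height-cell i j))

  glue-cong : ∀ {U V} → (∀ i → U i ≡ V i) → glue U ≡ glue V
  glue-cong U≡V = tabulate-cong (λ x → cong (λ W → lookup W (height x)) (U≡V (column x)))

  glue-slices : ∀ S → S ≡ glue (λ i → slice i S)
  glue-slices S = trans (sym (tabulate∘lookup S)) (tabulate-cong λ x → begin
    lookup S x                                   ≡⟨ cong (lookup S) (sym (cell-column-height x)) ⟩
    lookup S (cell (column x) (height x))        ≡⟨ sym (lookup∘tabulate _ (height x)) ⟩
    lookup (slice (column x) S) (height x)       ∎)

induced : (M : Structure) {n : ℕ} → (Fin n → Carrier M) → FinStructure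
induced M {n} ι = record
  { size = n
  ; E    = λ x y → E M (ι x) (ι y)
  ; P    = λ i x → P M i (ι x)
  ; Lt   = λ x y → Lt M (ι x) (ι y)
  }

induced-in-age : (M : Structure) {n : ℕ} (ι : Fin n → Carrier M) → Injective _≡_ _≡_ ι →
                 Age M (induced M ι)
induced-in-age M ι ι-inj = record
  { fun = ι ; inj = ι-inj ; E⇔ = λ _ _ → ⇔-id _ ; P⇔ = λ _ _ → ⇔-id _ ; Lt⇔ = λ _ _ → ⇔-id _ }

into-induced : (M : Structure) {n : ℕ} (ι : Fin n → Carrier M) {X : Structure}
  (e : Embedding X M) (g : Carrier X → Fin n) → (∀ x → fun e x ≡ ι (g x)) →
  Embedding X (toStructure (induced M ι))
into-induced M ι e g e≡ιg = record
  { fun = g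
  ; inj = λ {x} {y} gx≡gy → inj e (trans (e≡ιg x) (trans (cong ι gx≡gy) (sym (e≡ιg y))))
  ; E⇔  = λ x y → subst₂ (λ u v → _ ⇔ E M u v) (e≡ιg x) (e≡ιg y) (E⇔ e x y)
  ; P⇔  = λ i x → subst (λ u → _ ⇔ P M i u) (e≡ιg x) (P⇔ e i x)
  ; Lt⇔ = λ x y → subst₂ (λ u v → _ ⇔ Lt M u v) (e≡ιg x) (e≡ιg y) (Lt⇔ e x y)
  }

toℚ : ℕ → ℚ
toℚ n = mkℚ (ℤ.+ n) 0 (Coprime.sym (Coprime.1-coprimeTo n))

toℚ-mono : ∀ {m n} → m ℕ.< n → toℚ m ℚ.< toℚ n
toℚ-mono {m} {n} m<n =
  ℚ.*<* (subst₂ ℤ._<_ (sym (ℤ.*-identityʳ (ℤ.+ m))) (sym (ℤ.*-identityʳ (ℤ.+ n))) (ℤ.+<+ m<n))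

toℚ-injective : Injective _≡_ _≡_ toℚ
toℚ-injective {m} {n} e with <-cmp m n
... | tri< m<n _ _ = ⊥-elim (ℚ.<-irrefl e (toℚ-mono m<n))
... | tri≈ _ m≡n _ = m≡n
... | tri> _ _ n<m = ⊥-elim (ℚ.<-irrefl (sym e) (toℚ-mono n<m))

part : ∀ {A} → Age C3Iω* A → Fin (size A) → Fin 3
part e x = proj₁ (fun e x)

partClass : ∀ {A} → Age C3Iω* A → Fin 3 → Subset (size A)
partClass e i = select (λ x → part e x ≟ i)

∈-partClass : ∀ {A} (e : Age C3Iω* A) i x → x ∈ partClass e i ⇔ part e x ≡ i
∈-partClass e i = ∈-select (λ x → part e x ≟ i)

profile : ∀ {A} → Age C3Iω* A → Fin 3 → ℕ
profile e i = ∣ partClass e i ∣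

-- Changing the rational coordinates of an embedding into C₃[I_ω]* keeps
-- it an embedding, provided parts are kept and the order inside each part
-- is preserved: E and the P's only see parts, and the order inside a part
-- is then reflected by trichotomy.
relabel : ∀ {X} (e : Embedding X C3Iω*) (φ : Carrier X → Fin 3 × ℚ) →
  (∀ x → proj₁ (φ x) ≡ proj₁ (fun e x)) →
  (∀ x y → proj₁ (fun e x) ≡ proj₁ (fun e y) → proj₂ (fun e x) ℚ.< proj₂ (fun e y) →
           proj₂ (φ x) ℚ.< proj₂ (φ y)) →
  Embedding X C3Iω*
relabel {X} e φ same-part mono = record
  { fun = φ
  ; inj = φ-injective
  ; E⇔  = λ x y → subst₂ (λ u v → E X x y ⇔ C3Edge u v) (sym (same-part x)) (sym (same-part y)) (E⇔ e x y)
  ; P⇔  = λ i x → subst (λ u → P X i x ⇔ (u ≡ i)) (sym (same-part x)) (P⇔ e i x)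
  ; Lt⇔ = λ x y → mk⇔ (order-to x y) (order-from x y) ⇔-∘ Lt⇔ e x y
  }
  where
  q : Carrier X → ℚ
  q x = proj₂ (fun e x)
  same-point : ∀ {x y} → proj₁ (fun e x) ≡ proj₁ (fun e y) → q x ≡ q y → x ≡ y
  same-point p≡ q≡ = inj e (cong₂ _,_ p≡ q≡)
  reflect : ∀ x y → proj₁ (fun e x) ≡ proj₁ (fun e y) → proj₂ (φ x) ℚ.< proj₂ (φ y) → q x ℚ.< q y
  reflect x y p≡ φx<φy with ℚ.<-cmp (q x) (q y)
  ... | tri< qx<qy _ _ = qx<qy
  ... | tri≈ _ qx≡qy _ = ⊥-elim (ℚ.<-irrefl (cong (proj₂ ∘ φ) (same-point p≡ qx≡qy)) φx<φy)
  ... | tri> _ _ qy<qx = ⊥-elim (ℚ.<-asym φx<φy (mono y x (sym p≡) qy<qx))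
  φ-parts : ∀ {x y} → proj₁ (φ x) ≡ proj₁ (φ y) → proj₁ (fun e x) ≡ proj₁ (fun e y)
  φ-parts {x} {y} p≡ = trans (sym (same-part x)) (trans p≡ (same-part y))
  φ-injective : Injective _≡_ _≡_ φ
  φ-injective {x} {y} φ≡ with ℚ.<-cmp (q x) (q y)
  ... | tri< qx<qy _ _ = ⊥-elim (ℚ.<-irrefl (cong proj₂ φ≡) (mono x y (φ-parts (cong proj₁ φ≡)) qx<qy))
  ... | tri≈ _ qx≡qy _ = same-point (φ-parts (cong proj₁ φ≡)) qx≡qy
  ... | tri> _ _ qy<qx =
    ⊥-elim (ℚ.<-irrefl (cong proj₂ (sym φ≡)) (mono y x (φ-parts (cong proj₁ (sym φ≡))) qy<qx))
  order-to : ∀ x y → Lt C3Iω* (fun e x) (fun e y) → Lt C3Iω* (φ x) (φ y)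
  order-to x y (inj₁ p<p) = inj₁ (subst₂ F._<_ (sym (same-part x)) (sym (same-part y)) p<p)
  order-to x y (inj₂ (p≡ , q<q)) =
    inj₂ (trans (same-part x) (trans p≡ (sym (same-part y))) , mono x y p≡ q<q)
  order-from : ∀ x y → Lt C3Iω* (φ x) (φ y) → Lt C3Iω* (fun e x) (fun e y)
  order-from x y (inj₁ p<p) = inj₁ (subst₂ F._<_ (same-part x) (same-part y) p<p)
  order-from x y (inj₂ (p≡ , φ<φ)) = inj₂ (φ-parts p≡ , reflect x y (φ-parts p≡) φ<φ)

module C3Grid (N : ℕ) where
  open Grid 3 N public

  place : Fin (3 * N) → Fin 3 × ℚ
  place x = column x , toℚ (toℕ (height x))

  place-cell : ∀ i j → place (cell i j) ≡ (i , toℚ (toℕ j))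
  place-cell i j = cong₂ (λ i′ j′ → i′ , toℚ (toℕ j′)) (column-cell i j) (height-cell i j)

  place-injective : Injective _≡_ _≡_ place
  place-injective {x} {y} place≡ = begin
    x                          ≡⟨ sym (cell-column-height x) ⟩
    cell (column x) (height x) ≡⟨ cong₂ cell (cong proj₁ place≡)
                                            (toℕ-injective (toℚ-injective (cong proj₂ place≡))) ⟩
    cell (column y) (height y) ≡⟨ cell-column-height y ⟩
    y                          ∎

  grid : FinStructure
  grid = induced C3Iω* place

  grid-in-age : Age C3Iω* grid
  grid-in-age = induced-in-age C3Iω* place place-injective

  grid-part : ∀ {A} (eA : Age C3Iω* A) (g : Embedding (toStructure A) (toStructure grid)) x →
              column (fun g x) ≡ part eA x
  grid-part eA g x = to (P⇔ g (part eA x) x) (from (P⇔ eA (part eA x) x) refl)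

  -- In a copy of A in the grid, column i is the image of the points of A in
  -- part i, so it has profile eA i elements.
  copy-slices : ∀ {A} (eA : Age C3Iω* A) {S} → IsCopyOf A grid S →
                ∀ i → Σ[ t ∈ profile eA i ⊑ N ] toSub t ≡ slice i S
  copy-slices {A} eA {S} (g , image) i =
    thinning-of-size (slice i S) (image-size (slice i S) h h-injective h-image)
    where
    member : Fin (profile eA i) → Fin (size A)
    member = pos (fromSub (partClass eA i))
    h : Fin (profile eA i) → Fin N
    h k = height (fun g (member k))
    g-member : ∀ k → fun g (member k) ≡ cell i (h k)
    g-member k = in-column (trans (grid-part eA g (member k))
                                  (to (∈-partClass eA i _) (fromSub-∈ (partClass eA i) k)))
    h-injective : Injective _≡_ _≡_ h
    h-injective {k} {k′} hk≡hk′ = pos-injective (fromSub (partClass eA i))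
      (inj g (trans (g-member k) (trans (cong (cell i) hk≡hk′) (sym (g-member k′)))))
    into : ∀ {j} → j ∈ slice i S → ∃[ k ] h k ≡ j
    into {j} j∈ with to (image (cell i j)) (to (∈-slice i S j) j∈)
    ... | x , gx≡ij = k , (begin
      h k                     ≡⟨ cong (height ∘ fun g) mk≡x ⟩
      height (fun g x)        ≡⟨ cong height gx≡ij ⟩
      height (cell i j)       ≡⟨ height-cell i j ⟩
      j                       ∎)
      where
      x-part : part eA x ≡ i
      x-part = trans (sym (grid-part eA g x)) (trans (cong column gx≡ij) (column-cell i j))
      x-member = fromSub-onto (partClass eA i) (from (∈-partClass eA i x) x-part)
      k = proj₁ x-member
      mk≡x = proj₂ x-member
    out : ∀ {j} → ∃[ k ] h k ≡ j → j ∈ slice i S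
    out {j} (k , hk≡j) = from (∈-slice i S j)
      (subst (_∈ S) (trans (g-member k) (cong (cell i) hk≡j)) (from (image _) (member k , refl)))
    h-image : ∀ j → j ∈ slice i S ⇔ (∃[ k ] h k ≡ j)
    h-image j = mk⇔ into out

  copies-in-grid : ∀ {A} (eA : Age C3Iω* A) {m : Fin 3 → ℕ} (F : ∀ i → m i ⊑ N) {S} →
    S ⊆ glue (toSub ∘ F) → IsCopyOf A grid S →
    Σ[ u ∈ (∀ i → profile eA i ⊑ m i) ] S ≡ glue (λ i → toSub (u i ⨾ F i))
  copies-in-grid eA {m} F {S} S⊆F copy = (λ i → proj₁ (through i)) , (begin
    S                                         ≡⟨ glue-slices S ⟩
    glue (λ i → slice i S)                    ≡⟨ glue-cong (λ i → sym (proj₂ (copy-slices eA copy i))) ⟩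
    glue (λ i → toSub (column-thinning i))    ≡⟨ glue-cong (λ i → cong toSub (sym (proj₂ (through i)))) ⟩
    glue (λ i → toSub (proj₁ (through i) ⨾ F i)) ∎)
    where
    column-thinning : ∀ i → profile eA i ⊑ N
    column-thinning i = proj₁ (copy-slices eA copy i)
    column-inside : ∀ i → toSub (column-thinning i) ⊆ toSub (F i)
    column-inside i j∈ = to (∈-glue (toSub ∘ F) i _)
      (S⊆F (to (∈-slice i S _) (subst (_ ∈_) (proj₂ (copy-slices eA copy i)) j∈)))
    through : ∀ i → Σ[ u ∈ profile eA i ⊑ m i ] u ⨾ F i ≡ column-thinning i
    through i = factor (column-thinning i) (F i) (column-inside i)

  -- Given thinnings F i : size B ⊑ N, B has a copy inside the cells they
  -- select: y goes to column part y at height F(rank y), where rank y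
  -- counts the points of B with smaller rational coordinate.
  grid-copy : ∀ {B} (eB : Age C3Iω* B) (F : (i : Fin 3) → size B ⊑ N) →
    Σ[ B′ ∈ Subset (3 * N) ] (IsCopyOf B grid B′ × B′ ⊆ glue (toSub ∘ F))
  grid-copy {B} eB F = B′ , (embedding , ∈-select image?) , B′⊆F
    where
    open Ranking ℚ.<-trans (ℚ.<-irrefl refl) ℚ._<?_ (λ y → proj₂ (fun eB y))
    height-of : Fin (size B) → Fin N
    height-of y = pos (F (part eB y)) (rank y)
    at : Fin (size B) → Fin (3 * N)
    at y = cell (part eB y) (height-of y)
    height-mono : ∀ y y′ → part eB y ≡ part eB y′ → proj₂ (fun eB y) ℚ.< proj₂ (fun eB y′) →
                  height-of y F.< height-of y′
    height-mono y y′ p≡ q< = subst (λ i → height-of y F.< pos (F i) (rank y′)) p≡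
                                   (pos-mono (F (part eB y)) (rank-mono q<))
    relabelled : Embedding (toStructure B) C3Iω*
    relabelled = relabel eB (λ y → part eB y , toℚ (toℕ (height-of y))) (λ _ → refl)
                         (λ y y′ p≡ q< → toℚ-mono (height-mono y y′ p≡ q<))
    embedding : Embedding (toStructure B) (toStructure grid)
    embedding = into-induced C3Iω* place relabelled at (λ y → sym (place-cell _ _))
    image? : ∀ x → Dec (∃[ y ] at y ≡ x)
    image? x = any? (λ y → at y ≟ x)
    B′ : Subset (3 * N)
    B′ = select image?
    at-in-F : ∀ y → at y ∈ glue (toSub ∘ F)
    at-in-F y = from (∈-glue (toSub ∘ F) (part eB y) (height-of y))
                     (toSub-pos (F (part eB y)) (rank y))
    B′⊆F : B′ ⊆ glue (toSub ∘ F)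
    B′⊆F {x} x∈ = let y , at≡x = to (∈-select image? x) x∈
                  in subst (_∈ glue (toSub ∘ F)) at≡x (at-in-F y)

-- With no colours there is nothing to colour.  Otherwise take the grid of
-- height N given by the product Ramsey theorem for the profile of A, colour
-- a tuple of column thinnings by the subset it selects, and take the copy
-- of B inside the cells of the homogeneous tuple F: every copy of A in it
-- is selected by a tuple u i ⨾ F i, so all of them get the same colour.
theorem5p6 : RamseyProperty (Age C3Iω*)
theorem5p6 zero    A B eA eB = B , eB , λ χ → ⊥-elim (¬Fin0 (χ Sub.⊥))
theorem5p6 (suc k) A B eA eB = grid , grid-in-age , homogeneous-copy
  where
  N = proj₁ (product-ramsey k (profile eA) (λ _ → size B))
  open C3Grid N
  homogeneous-copy : (χ : Subset (3 * N) → Fin (suc k)) → Σ[ B′ ∈ Subset (3 * N) ]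
    (IsCopyOf B grid B′ × (∀ S T → S ⊆ B′ → T ⊆ B′ → IsCopyOf A grid S → IsCopyOf A grid T → χ S ≡ χ T))
  homogeneous-copy χ = B′ , copyB , λ S T S⊆B′ T⊆B′ copyS copyT →
    let uS , S≡ = copies-in-grid eA F (λ x∈ → B′⊆F (S⊆B′ x∈)) copyS
        uT , T≡ = copies-in-grid eA F (λ x∈ → B′⊆F (T⊆B′ x∈)) copyT
    in begin
      χ S                       ≡⟨ cong χ S≡ ⟩
      colour (λ i → uS i ⨾ F i) ≡⟨ homogeneous uS uT ⟩
      colour (λ i → uT i ⨾ F i) ≡⟨ cong χ (sym T≡) ⟩
      χ T                       ∎
    where
    colour : ((i : Fin 3) → profile eA i ⊑ N) → Fin (suc k)
    colour t = χ (glue (λ i → toSub (t i)))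
    homogeneous-tuple = proj₂ (product-ramsey k (profile eA) (λ _ → size B)) colour
                              (λ t≡t′ → cong χ (glue-cong (λ i → cong toSub (t≡t′ i))))
    F = proj₁ homogeneous-tuple
    homogeneous = proj₂ homogeneous-tuple
    B′ = proj₁ (grid-copy eB F)
    copyB = proj₁ (proj₂ (grid-copy eB F))
    B′⊆F = proj₂ (proj₂ (grid-copy eB F))
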